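{- Let $a,b,c$ be pairwise coprime positive integers with $a<b<c$ and $a\mid b+c$. Then there exists a positive integer $k_1$ such that every $s\in\langle a,b,c\rangle$ can be written uniquely either as $ax+by$ or as $ax+cz$, where $x\in\mathbb{N}$, $y\in\{0,1,\ldots,k_1-1\}$ and $z\in\{1,2,\ldots,a-k_1\}$.
   Context: $\mathbb{N}$ denotes the non-negative integers and $\langle a,b,c\rangle=\{ax_1+bx_2+cx_3 : x_i\in\mathbb{N}\}$. -}

module Defs where

open import Data.Nat using (ℕ; _+_; _*_; _∸_; _≤_; _<_)
open import Data.Product using (_×_; ∃-syntax; Σ-syntax; _,_)
open import Data.Sum using (_⊎_; inj₁; inj₂)
open import Relation.Binary.PropositionalEquality using (_≡_)

_∈⟨_,_,_⟩ : ℕ → ℕ → ℕ → ℕ → Set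
s ∈⟨ a , b , c ⟩ = ∃[ x₁ ] ∃[ x₂ ] ∃[ x₃ ] a * x₁ + b * x₂ + c * x₃ ≡ s

-- A candidate representation: either (x , y) meaning a x + b y,
-- or (x , z) meaning a x + c z.
Repr : Set
Repr = (ℕ × ℕ) ⊎ (ℕ × ℕ)

IsRepr : ℕ → ℕ → ℕ → ℕ → ℕ → Repr → Set
IsRepr a b c k₁ s (inj₁ (x , y)) = y < k₁ × a * x + b * y ≡ s
IsRepr a b c k₁ s (inj₂ (x , z)) = 1 ≤ z × z ≤ a ∸ k₁ × a * x + c * z ≡ s

UniqueRepr : ℕ → ℕ → ℕ → ℕ → ℕ → Set
UniqueRepr a b c k₁ s =
  Σ[ r ∈ Repr ] (IsRepr a b c k₁ s r × (∀ r′ → IsRepr a b c k₁ s r′ → r′ ≡ r))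

-- Since b ≡ −c (mod a), the numbers b·t and c·(a − t) are congruent modulo a, so the smaller
-- of the two can always replace the larger at the cost of a multiple of a. Take k₁ to be the
-- least t with c·(a − t) < b·t; it lies in [1, a]. Below k₁ the b-form is the cheaper one and
-- above it the c-form, so every residue y of the b-coefficient with y ≥ k₁ is traded for
-- z = a − y, and every residue z of the c-coefficient with z > a − k₁ for y = a − z. Uniqueness:
-- within one form the coefficient y (or z) is a residue modulo a coprime to b (or c), and a
-- mixed coincidence a x + b y = a x' + c z would give a ∣ b (y + z) with 0 < y + z < a.
module Submission where

open import Defs
open import Data.Nat using (ℕ; zero; suc; _+_; _*_; _∸_; _<_; _≤_; z≤n; s≤s; s≤s⁻¹; NonZero; >-nonZero; _<?_; _≤?_)
open import Data.Nat.Properties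
open import Data.Nat.Divisibility using (_∣_; quotient; ∣-trans; ∣m∣n⇒∣m+n; ∣m+n∣m⇒∣n; m∣m*n; n∣m*n; ∣⇒≤)
open import Data.Nat.Coprimality using (Coprime; coprime-divisor)
open import Data.Nat.DivMod using (_/_; _%_; m≡m%n+[m/n]*n; m%n<n)
open import Data.Nat.Solver using (module +-*-Solver)
open import Data.Product using (Σ; _×_; _,_; ∃-syntax)
open import Data.Sum using (inj₁; inj₂)
open import Data.Empty using (⊥; ⊥-elim)
open import Function using (_∘_)
open import Relation.Nullary using (¬_; yes; no; contradiction)
open import Relation.Unary using (Decidable)
open import Relation.Binary.PropositionalEquality
open +-*-Solver
open ≡-Reasoning

least : (P : ℕ → Set) → Decidable P → ∀ n → P n →
        ∃[ k ] (k ≤ n × P k × (∀ t → t < k → ¬ P t))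
least P P? zero p = 0 , z≤n , p , λ _ ()
least P P? (suc n) p with P? 0
... | yes p0 = 0 , z≤n , p0 , λ _ ()
... | no ¬p0 with least (P ∘ suc) (P? ∘ suc) n p
...   | k , k≤n , pk , below = suc k , s≤s k≤n , pk , λ where
  zero _ → ¬p0
  (suc t) t<k → below t (s≤s⁻¹ t<k)

threshold : ∀ {a b} c → 0 < a → 0 < b →
  ∃[ k ] (1 ≤ k × k ≤ a × (∀ t → t < k → b * t ≤ c * (a ∸ t))
                         × (∀ t → k ≤ t → c * (a ∸ t) ≤ b * t))
threshold {a} {b} c 0<a 0<b
  with least (λ t → c * (a ∸ t) < b * t) (λ t → c * (a ∸ t) <? b * t) a exceeds-at-a
  where
    exceeds-at-a : c * (a ∸ a) < b * a
    exceeds-at-a = subst (_< b * a) (sym (trans (cong (c *_) (n∸n≡0 a)) (*-zeroʳ c)))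
                         (*-mono-≤ 0<b 0<a)
... | zero , _ , exceeds-at-0 , _ = contradiction (subst (c * a <_) (*-zeroʳ b) exceeds-at-0) n≮0
... | k@(suc _) , k≤a , exceeds-at-k , below = k , s≤s z≤n , k≤a , below-k , from-k
  where
    below-k : ∀ t → t < k → b * t ≤ c * (a ∸ t)
    below-k t t<k = ≮⇒≥ (below t t<k)

    from-k : ∀ t → k ≤ t → c * (a ∸ t) ≤ b * t
    from-k t k≤t = ≤-trans (*-monoʳ-≤ c (∸-monoʳ-≤ a k≤t))
                           (≤-trans (<⇒≤ exceeds-at-k) (*-monoʳ-≤ b k≤t))

coprime-∣*-<⇒≡0 : ∀ {a e d} → Coprime a e → a ∣ e * d → d < a → d ≡ 0
coprime-∣*-<⇒≡0 {d = zero} _ _ _ = refl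
coprime-∣*-<⇒≡0 {d = suc _} a⊥e a∣ed d<a =
  contradiction (∣⇒≤ (coprime-divisor a⊥e a∣ed)) (<⇒≱ d<a)

coprime-residue-≤⇒≡ : ∀ {a e x x′ y y′} → Coprime a e → a * x + e * y ≡ a * x′ + e * y′ →
                      y ≤ y′ → y′ < a → y ≡ y′
coprime-residue-≤⇒≡ {a} {e} {x} {x′} {y} {y′} a⊥e eq y≤y′ y′<a =
  trans (sym (+-identityʳ y)) (trans (cong (y +_) (sym d≡0)) (m+[n∸m]≡n y≤y′))
  where
    d = y′ ∸ y
    a*x≡a*x′+e*d : a * x ≡ a * x′ + e * d
    a*x≡a*x′+e*d = +-cancelʳ-≡ (e * y) (a * x) (a * x′ + e * d) (begin
      a * x + e * y         ≡⟨ eq ⟩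
      a * x′ + e * y′        ≡⟨ cong (λ u → a * x′ + e * u) (sym (m+[n∸m]≡n y≤y′)) ⟩
      a * x′ + e * (y + d)   ≡⟨ solve 5 (λ a x′ e y d → a :* x′ :+ e :* (y :+ d)
                                                     := (a :* x′ :+ e :* d) :+ e :* y) refl a x′ e y d ⟩
      a * x′ + e * d + e * y ∎)
    d≡0 : d ≡ 0
    d≡0 = coprime-∣*-<⇒≡0 a⊥e (∣m+n∣m⇒∣n (subst (a ∣_) a*x≡a*x′+e*d (m∣m*n x)) (m∣m*n x′))
                          (≤-<-trans (m∸n≤m y′ y) y′<a)

coprime-residue-unique : ∀ {a e x x′ y y′} .{{_ : NonZero a}} → Coprime a e →
  a * x + e * y ≡ a * x′ + e * y′ → y < a → y′ < a → (x , y) ≡ (x′ , y′)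
coprime-residue-unique {a} {e} {x} {x′} {y} {y′} a⊥e eq y<a y′<a = cong₂ _,_ x≡x′ y≡y′
  where
    y≡y′ : y ≡ y′
    y≡y′ with ≤-total y y′
    ... | inj₁ y≤y′ = coprime-residue-≤⇒≡ a⊥e eq y≤y′ y′<a
    ... | inj₂ y′≤y = sym (coprime-residue-≤⇒≡ a⊥e (sym eq) y′≤y y<a)
    x≡x′ : x ≡ x′
    x≡x′ = *-cancelˡ-≡ x x′ a
             (+-cancelʳ-≡ (e * y) (a * x) (a * x′) (trans eq (cong (λ u → a * x′ + e * u) (sym y≡y′))))

mixed-residue-sum≡0 : ∀ {a b c x x′ y z} → Coprime a b → a ∣ b + c →
  a * x + b * y ≡ a * x′ + c * z → y + z < a → y + z ≡ 0
mixed-residue-sum≡0 {a} {b} {c} {x} {x′} {y} {z} a⊥b a∣b+c eq y+z<a =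
  coprime-∣*-<⇒≡0 a⊥b (∣m+n∣m⇒∣n (subst (a ∣_) (sym lhs≡rhs) a∣rhs) (m∣m*n x)) y+z<a
  where
    lhs≡rhs : a * x + b * (y + z) ≡ a * x′ + (b + c) * z
    lhs≡rhs = begin
      a * x + b * (y + z)     ≡⟨ solve 5 (λ a x b y z → a :* x :+ b :* (y :+ z)
                                          := (a :* x :+ b :* y) :+ b :* z) refl a x b y z ⟩
      a * x + b * y + b * z   ≡⟨ cong (_+ b * z) eq ⟩
      a * x′ + c * z + b * z   ≡⟨ solve 5 (λ a x′ c z b → a :* x′ :+ c :* z :+ b :* z
                                          := a :* x′ :+ (b :+ c) :* z) refl a x′ c z b ⟩
      a * x′ + (b + c) * z     ∎
    a∣rhs : a ∣ a * x′ + (b + c) * z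
    a∣rhs = ∣m∣n⇒∣m+n (m∣m*n x′) (∣-trans a∣b+c (m∣m*n z))

-- If y + z = a then e·y − f·z = e·a − (e + f)·z, a multiple of a.
trade : ∀ {a} x e y f z → a ∣ e + f → y + z ≡ a → f * z ≤ e * y →
        ∃[ q ] a * x + e * y ≡ a * (x + q) + f * z
trade {a} x e y f z a∣e+f y+z≡a fz≤ey = q , (begin
  a * x + e * y             ≡⟨ cong (a * x +_) (sym (m+[n∸m]≡n fz≤ey)) ⟩
  a * x + (f * z + w)       ≡⟨ cong (λ u → a * x + (f * z + u)) w≡q*a ⟩
  a * x + (f * z + q * a)   ≡⟨ solve 5 (λ a x f z q → a :* x :+ (f :* z :+ q :* a)
                                        := a :* (x :+ q) :+ f :* z) refl a x f z q ⟩
  a * (x + q) + f * z       ∎)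
  where
    w = e * y ∸ f * z
    [e+f]z+w≡e*a : (e + f) * z + w ≡ e * a
    [e+f]z+w≡e*a = begin
      (e + f) * z + w       ≡⟨ solve 4 (λ w e f z → (e :+ f) :* z :+ w
                                        := (f :* z :+ w) :+ e :* z) refl w e f z ⟩
      (f * z + w) + e * z   ≡⟨ cong (_+ e * z) (m+[n∸m]≡n fz≤ey) ⟩
      e * y + e * z         ≡⟨ sym (*-distribˡ-+ e y z) ⟩
      e * (y + z)           ≡⟨ cong (e *_) y+z≡a ⟩
      e * a                 ∎
    a∣w : a ∣ w
    a∣w = ∣m+n∣m⇒∣n (subst (a ∣_) (sym [e+f]z+w≡e*a) (n∣m*n e)) (∣-trans a∣e+f (m∣m*n z))
    q = quotient a∣w
    w≡q*a : w ≡ q * a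
    w≡q*a = _∣_.equality a∣w

m∸n<o⇒m∸o<n : ∀ {m n o} → n ≤ m → o ≤ m → m ∸ n < o → m ∸ o < n
m∸n<o⇒m∸o<n {m} {o = o} n≤m o≤m m∸n<o = subst (m ∸ o <_) (m∸[m∸n]≡n n≤m) (∸-monoʳ-< m∸n<o o≤m)

absorb-multiple : ∀ a x e r q → a * x + e * (r + q * a) ≡ a * (x + e * q) + e * r
absorb-multiple = solve 5 (λ a x e r q → a :* x :+ e :* (r :+ q :* a)
                                      := a :* (x :+ e :* q) :+ e :* r) refl

module Representation (a b c k : ℕ) .{{_ : NonZero a}}
  (a⊥b : Coprime a b) (a⊥c : Coprime a c) (a∣b+c : a ∣ b + c)
  (1≤k : 1 ≤ k) (k≤a : k ≤ a)
  (below-k : ∀ t → t < k → b * t ≤ c * (a ∸ t))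
  (from-k : ∀ t → k ≤ t → c * (a ∸ t) ≤ b * t) where

  Rep : ℕ → Set
  Rep s = Σ Repr (IsRepr a b c k s)

  a∣c+b : a ∣ c + b
  a∣c+b = subst (a ∣_) (+-comm b c) a∣b+c

  to-c-form : ∀ x {y} → y < a → k ≤ y → Rep (a * x + b * y)
  to-c-form x {y} y<a k≤y =
    let q , eq = trade x b y c (a ∸ y) a∣b+c (m+[n∸m]≡n (<⇒≤ y<a)) (from-k y k≤y)
    in inj₂ (x + q , a ∸ y) , m<n⇒0<n∸m y<a , ∸-monoʳ-≤ a k≤y , sym eq

  to-b-form : ∀ x {z} → z ≤ a → a ∸ z < k → Rep (a * x + c * z)
  to-b-form x {z} z≤a a∸z<k =
    let q , eq = trade x c z b (a ∸ z) a∣c+b (m+[n∸m]≡n z≤a)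
                   (subst (λ u → b * (a ∸ z) ≤ c * u) (m∸[m∸n]≡n z≤a) (below-k (a ∸ z) a∸z<k))
    in inj₁ (x + q , a ∸ z) , a∸z<k , sym eq

  rep-b-residue : ∀ x {y} → y < a → Rep (a * x + b * y)
  rep-b-residue x {y} y<a with y <? k
  ... | yes y<k = inj₁ (x , y) , y<k , refl
  ... | no y≮k = to-c-form x y<a (≮⇒≥ y≮k)

  rep-c-residue : ∀ x {z} → 1 ≤ z → z ≤ a → Rep (a * x + c * z)
  rep-c-residue x {z} 1≤z z≤a with z ≤? a ∸ k
  ... | yes z≤a∸k = inj₂ (x , z) , 1≤z , z≤a∸k , refl
  ... | no z≰a∸k = to-b-form x z≤a (m∸n<o⇒m∸o<n k≤a z≤a (≰⇒> z≰a∸k))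

  rep-b : ∀ x y → Rep (a * x + b * y)
  rep-b x y = subst Rep (sym split) (rep-b-residue (x + b * (y / a)) (m%n<n y a))
    where
      split : a * x + b * y ≡ a * (x + b * (y / a)) + b * (y % a)
      split = trans (cong (λ u → a * x + b * u) (m≡m%n+[m/n]*n y a))
                    (absorb-multiple a x b (y % a) (y / a))

  -- The residue of z is taken in [1, a] rather than [0, a), since c·0 is not a c-form.
  rep-c : ∀ x z → Rep (a * x + c * suc z)
  rep-c x z = subst Rep (sym split) (rep-c-residue (x + c * (z / a)) (s≤s z≤n) (m%n<n z a))
    where
      split : a * x + c * suc z ≡ a * (x + c * (z / a)) + c * suc (z % a)
      split = trans (cong (λ u → a * x + c * suc u) (m≡m%n+[m/n]*n z a))
                    (absorb-multiple a x c (suc (z % a)) (z / a))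

  rep : ∀ x y z → Rep (a * x + b * y + c * z)
  rep x y zero =
    subst Rep (trans (sym (+-identityʳ _)) (cong (a * x + b * y +_) (sym (*-zeroʳ c)))) (rep-b x y)
  rep x zero (suc z) =
    subst Rep (cong (_+ c * suc z) (trans (sym (+-identityʳ _)) (cong (a * x +_) (sym (*-zeroʳ b)))))
          (rep-c x z)
  rep x (suc y) (suc z) =
    subst Rep (begin
      a * (x + m) + b * y + c * z       ≡⟨ solve 7 (λ a x m b y c z → a :* (x :+ m) :+ b :* y :+ c :* z
                                              := a :* x :+ m :* a :+ b :* y :+ c :* z) refl a x m b y c z ⟩
      a * x + m * a + b * y + c * z     ≡⟨ cong (λ u → a * x + u + b * y + c * z) (sym b+c≡m*a) ⟩
      a * x + (b + c) + b * y + c * z   ≡⟨ solve 6 (λ a x b c y z → a :* x :+ (b :+ c) :+ b :* y :+ c :* z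
                                              := a :* x :+ b :* (con 1 :+ y) :+ c :* (con 1 :+ z)) refl a x b c y z ⟩
      a * x + b * suc y + c * suc z     ∎)
      (rep (x + m) y z)
    where
      m = quotient a∣b+c
      b+c≡m*a : b + c ≡ m * a
      b+c≡m*a = _∣_.equality a∣b+c

  no-mixed-rep : ∀ {x x′ y z} → a * x + b * y ≡ a * x′ + c * z → y < k → 1 ≤ z → z ≤ a ∸ k → ⊥
  no-mixed-rep {y = y} {z} eq y<k 1≤z z≤a∸k =
    contradiction (m+n≡0⇒n≡0 y (mixed-residue-sum≡0 a⊥b a∣b+c eq y+z<a)) (≢-sym (<⇒≢ 1≤z))
    where
      y+z<a : y + z < a
      y+z<a = subst (y + z <_) (m+[n∸m]≡n k≤a) (+-mono-<-≤ y<k z≤a∸k)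

  a∸k<a : a ∸ k < a
  a∸k<a = ∸-monoʳ-< 1≤k k≤a

  rep-unique : ∀ {s} r r′ → IsRepr a b c k s r → IsRepr a b c k s r′ → r′ ≡ r
  rep-unique (inj₁ _) (inj₁ _) (y<k , e) (y′<k , e′) =
    cong inj₁ (coprime-residue-unique a⊥b (trans e′ (sym e)) (<-≤-trans y′<k k≤a) (<-≤-trans y<k k≤a))
  rep-unique (inj₂ _) (inj₂ _) (_ , z≤ , e) (_ , z′≤ , e′) =
    cong inj₂ (coprime-residue-unique a⊥c (trans e′ (sym e)) (≤-<-trans z′≤ a∸k<a) (≤-<-trans z≤ a∸k<a))
  rep-unique (inj₁ _) (inj₂ _) (y<k , e) (1≤z , z≤ , e′) = ⊥-elim (no-mixed-rep (trans e (sym e′)) y<k 1≤z z≤)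
  rep-unique (inj₂ _) (inj₁ _) (1≤z , z≤ , e) (y<k , e′) = ⊥-elim (no-mixed-rep (trans e′ (sym e)) y<k 1≤z z≤)

  unique-repr : ∀ s → s ∈⟨ a , b , c ⟩ → UniqueRepr a b c k s
  unique-repr s (x , y , z , s≡) with r , is-r ← subst Rep s≡ (rep x y z) =
    r , is-r , λ r′ is-r′ → rep-unique r r′ is-r is-r′

proposition4p1 : (a b c : ℕ) → 0 < a → a < b → b < c →
    Coprime a b → Coprime a c → Coprime b c → a ∣ b + c →
    ∃[ k₁ ] (1 ≤ k₁ × (∀ s → s ∈⟨ a , b , c ⟩ → UniqueRepr a b c k₁ s))
proposition4p1 a b c 0<a a<b _ a⊥b a⊥c _ a∣b+c
  with k , 1≤k , k≤a , below-k , from-k ← threshold c 0<a (<-trans 0<a a<b) =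
  k , 1≤k , unique-repr
  where open Representation a b c k {{>-nonZero 0<a}} a⊥b a⊥c a∣b+c 1≤k k≤a below-k from-k
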